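{- If $a$, $b$, $s$ are positive integers with $a^s=b$, then for all positive integers $n,R$, $$M(n,R,b)\le s^2\left\lceil\frac{M(sn,R,a)+sn}{s}\right\rceil-s.$$
   Context: For integers $n,R\ge0$ and $q\ge1$, an $(n,R,q)$-de Bruijn covering code of length $M$ is a string $S=(s_0,\ldots,s_{M-1})$ over $\mathbb{Z}/q\mathbb{Z}$ such that every string in $(\mathbb{Z}/q\mathbb{Z})^n$ differs in at most $R$ coordinates from some $n$-string $(s_i,\ldots,s_{i+n-1})$, $0\le i\le M-1$, indices taken modulo $M$. $M(n,R,q)$ denotes the smallest length of an $(n,R,q)$-de Bruijn covering code. -}

module Defs where

open import Data.Nat using (ℕ; zero; suc; _+_; _*_; _∸_; _≤_; _/_)
open import Data.Nat.DivMod using (_mod_)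
open import Data.Fin using (Fin; toℕ) renaming (zero to fzero; suc to fsuc)
open import Data.Fin.Properties using (_≟_)
open import Data.Product using (Σ; _×_)
open import Relation.Nullary using (yes; no)

hamming : ∀ {q} (n : ℕ) → (Fin n → Fin q) → (Fin n → Fin q) → ℕ
hamming zero    u v = 0
hamming (suc n) u v with u fzero ≟ v fzero
... | yes _ = hamming n (λ j → u (fsuc j)) (λ j → v (fsuc j))
... | no  _ = suc (hamming n (λ j → u (fsuc j)) (λ j → v (fsuc j)))

cycIdx : (M : ℕ) → Fin M → ℕ → Fin M
cycIdx (suc m) i j = (toℕ i + j) mod (suc m)

window : ∀ {q} (n M : ℕ) → (Fin M → Fin q) → Fin M → Fin n → Fin q
window n M S i j = S (cycIdx M i (toℕ j))

IsDBCoveringCode : (n R q M : ℕ) → (Fin M → Fin q) → Set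
IsDBCoveringCode n R q M S =
  (w : Fin n → Fin q) → Σ (Fin M) (λ i → hamming n w (window n M S i) ≤ R)

HasDBCoveringCode : (n R q M : ℕ) → Set
HasDBCoveringCode n R q M = Σ (Fin M → Fin q) (IsDBCoveringCode n R q M)

-- m = M(n,R,q): m is the smallest length of an (n,R,q)-de Bruijn covering code.
IsMinDBLength : (n R q m : ℕ) → Set
IsMinDBLength n R q m =
  HasDBCoveringCode n R q m × ((k : ℕ) → HasDBCoveringCode n R q k → m ≤ k)

ceilDiv : ℕ → ℕ → ℕ
ceilDiv x zero    = 0
ceilDiv x (suc t) = (x + t) / suc t

{-# OPTIONS --safe #-}
-- A letter of ℤ/a^s is a block of s letters of ℤ/a.  From an (sn,R,a)-code S of length M,
-- form for each offset r < s the string of the K = n + ⌊(M-1)/s⌋ consecutive s-blocks of S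
-- starting at r, r + s, r + 2s, …, and concatenate these s strings into a string T of length
-- sK over ℤ/a^s.  A word w of length n over ℤ/a^s, spelled out over ℤ/a, is within distance
-- R of the window of S at some i = r + js; the window of T at block j of the string for
-- offset r reads exactly the n blocks of S in that window, and a letter of w can differ from
-- it only if its block contains a mismatch.  So T is an (n,R,a^s)-code, and
-- sK ≤ s²⌈(M+sn)/s⌉ − s.
module Submission where

open import Defs
open import Data.Empty using (⊥-elim)
open import Data.Fin using (Fin; toℕ; fromℕ<; cast; combine; remQuot; finToFun; funToFin; _↑ˡ_; _↑ʳ_)
  renaming (zero to fzero; suc to fsuc)
open import Data.Fin.Properties
  using (_≟_; ¬Fin0; toℕ<n; toℕ-fromℕ<; toℕ-cast; cast-is-id; cast-involutive; toℕ-combine;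
         remQuot-combine; funToFin-finToFin)
open import Data.Nat
  using (ℕ; zero; suc; _+_; _*_; _∸_; _^_; _≤_; _<_; z≤n; NonZero; >-nonZero⁻¹; _/_; _%_)
open import Data.Nat.DivMod
  using (_mod_; m%n<n; m<n⇒m%n≡m; [m+kn]%n≡m%n; m≡m%n+[m/n]*n; m<n⇒m/n≡0; m*n/n≡m;
         +-distrib-/-∣ʳ; /-monoˡ-≤)
open import Data.Nat.Divisibility using (n∣m*n)
open import Data.Nat.Properties hiding (_≟_)
open import Algebra.Properties.CommutativeSemigroup +-commutativeSemigroup using (xy∙z≈xz∙y)
open import Data.Product using (_,_; proj₁; proj₂; uncurry)
open import Function using (_∘_)
open import Relation.Binary.PropositionalEquality
open import Relation.Nullary using (yes; no)

private
  variable
    q q′ : ℕ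

hamming-cong : ∀ n {u u′ v v′ : Fin n → Fin q} → u ≗ u′ → v ≗ v′ →
  hamming n u v ≡ hamming n u′ v′
hamming-cong zero    eu ev = refl
hamming-cong (suc n) {u} {u′} {v} {v′} eu ev with u fzero ≟ v fzero | u′ fzero ≟ v′ fzero
... | yes _ | yes _ = hamming-cong n (eu ∘ fsuc) (ev ∘ fsuc)
... | no  _ | no  _ = cong suc (hamming-cong n (eu ∘ fsuc) (ev ∘ fsuc))
... | yes e | no ¬e = ⊥-elim (¬e (trans (sym (eu fzero)) (trans e (ev fzero))))
... | no ¬e | yes e = ⊥-elim (¬e (trans (eu fzero) (trans e (sym (ev fzero)))))

hamming-cast : ∀ {m n} (eq : m ≡ n) (u v : Fin n → Fin q) →
  hamming m (u ∘ cast eq) (v ∘ cast eq) ≡ hamming n u v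
hamming-cast {m = m} refl u v = hamming-cong m (cong u ∘ cast-is-id refl) (cong v ∘ cast-is-id refl)

hamming-++ : ∀ m n (u v : Fin (m + n) → Fin q) →
  hamming (m + n) u v ≡ hamming m (u ∘ (_↑ˡ n)) (v ∘ (_↑ˡ n)) + hamming n (u ∘ (m ↑ʳ_)) (v ∘ (m ↑ʳ_))
hamming-++ zero    n u v = refl
hamming-++ (suc m) n u v with u fzero ≟ v fzero
... | yes _ = hamming-++ m n (u ∘ fsuc) (v ∘ fsuc)
... | no  _ = cong suc (hamming-++ m n (u ∘ fsuc) (v ∘ fsuc))

hamming≡0⇒≗ : ∀ n {u v : Fin n → Fin q} → hamming n u v ≡ 0 → u ≗ v
hamming≡0⇒≗ (suc n) {u} {v} eq i with u fzero ≟ v fzero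
hamming≡0⇒≗ (suc n) eq fzero    | yes e = e
hamming≡0⇒≗ (suc n) eq (fsuc i) | yes _ = hamming≡0⇒≗ n eq i
hamming≡0⇒≗ (suc n) () i        | no  _

hamming-≤-combine : ∀ n s (u v : Fin n → Fin q) (u′ v′ : Fin (n * s) → Fin q′) →
  (∀ k → (∀ t → u′ (combine k t) ≡ v′ (combine k t)) → u k ≡ v k) →
  hamming n u v ≤ hamming (n * s) u′ v′
hamming-≤-combine zero    s u v u′ v′ agree = z≤n
hamming-≤-combine (suc n) s u v u′ v′ agree
  rewrite hamming-++ s (n * s) u′ v′
  with u fzero ≟ v fzero
     | hamming-≤-combine n s (u ∘ fsuc) (v ∘ fsuc) (u′ ∘ (s ↑ʳ_)) (v′ ∘ (s ↑ʳ_)) (agree ∘ fsuc)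
... | yes _     | rest = ≤-trans rest (m≤n+m _ _)
... | no u₀≢v₀ | rest = +-mono-≤ (n≢0⇒n>0 (u₀≢v₀ ∘ agree fzero ∘ hamming≡0⇒≗ s)) rest

blockIndex : ∀ {n s} → Fin n → Fin s → Fin (s * n)
blockIndex {n} {s} k t = cast (*-comm n s) (combine k t)

toℕ-blockIndex : ∀ {n s} (k : Fin n) (t : Fin s) → toℕ (blockIndex k t) ≡ s * toℕ k + toℕ t
toℕ-blockIndex {n} {s} k t = trans (toℕ-cast (*-comm n s) (combine k t)) (toℕ-combine k t)

hamming-≤-blocks : ∀ n s (u v : Fin n → Fin q) (u′ v′ : Fin (s * n) → Fin q′) →
  (∀ k → (∀ t → u′ (blockIndex k t) ≡ v′ (blockIndex k t)) → u k ≡ v k) →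
  hamming n u v ≤ hamming (s * n) u′ v′
hamming-≤-blocks n s u v u′ v′ agree =
  subst (hamming n u v ≤_) (hamming-cast (*-comm n s) u′ v′)
    (hamming-≤-combine n s u v (u′ ∘ cast (*-comm n s)) (v′ ∘ cast (*-comm n s)) agree)

unblock : ∀ {a n} s → (Fin n → Fin (a ^ s)) → Fin (s * n) → Fin a
unblock {n = n} s u x = uncurry (finToFun ∘ u) (remQuot s (cast (*-comm s n) x))

unblock-blockIndex : ∀ {a n} s (u : Fin n → Fin (a ^ s)) k t →
  unblock s u (blockIndex k t) ≡ finToFun (u k) t
unblock-blockIndex {n = n} s u k t = cong (uncurry (finToFun ∘ u))
  (trans (cong (remQuot s) (cast-involutive (*-comm s n) (*-comm n s) (combine k t)))
         (remQuot-combine k t))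

funToFin-cong : ∀ {m n} {f g : Fin m → Fin n} → f ≗ g → funToFin f ≡ funToFin g
funToFin-cong {zero}  eq = refl
funToFin-cong {suc m} eq = cong₂ combine (eq fzero) (funToFin-cong (eq ∘ fsuc))

[m+kn]/n≡m/n+k : ∀ m k n .{{_ : NonZero n}} → (m + k * n) / n ≡ m / n + k
[m+kn]/n≡m/n+k m k n = trans (+-distrib-/-∣ʳ m (n∣m*n k)) (cong (m / n +_) (m*n/n≡m k n))

m<n⇒[m+kn]/n≡k : ∀ {m n} k .{{_ : NonZero n}} → m < n → (m + k * n) / n ≡ k
m<n⇒[m+kn]/n≡k {m} {n} k m<n = trans ([m+kn]/n≡m/n+k m k n) (cong (_+ k) (m<n⇒m/n≡0 m<n))

m<n⇒[m+kn]%n≡m : ∀ {m n} k .{{_ : NonZero n}} → m < n → (m + k * n) % n ≡ m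
m<n⇒[m+kn]%n≡m {m} {n} k m<n = trans ([m+kn]%n≡m%n m k n) (m<n⇒m%n≡m m<n)

m<n⇒m+k*n<o*n : ∀ {m n k o} → m < n → k < o → m + k * n < o * n
m<n⇒m+k*n<o*n {n = n} {k} m<n k<o = ≤-trans (+-monoˡ-< (k * n) m<n) (*-monoˡ-≤ n k<o)

toℕ-cycIdx : ∀ {M} (i : Fin M) j → toℕ i + j < M → toℕ (cycIdx M i j) ≡ toℕ i + j
toℕ-cycIdx {suc m} i j i+j<M = trans (toℕ-fromℕ< _) (m<n⇒m%n≡m i+j<M)

chunk : ∀ {a m} s → (Fin (suc m) → Fin a) → ℕ → Fin (a ^ s)
chunk {m = m} s S x = funToFin (λ (t : Fin s) → S ((x + toℕ t) mod suc m))

blockString : ∀ {a m} s K .{{_ : NonZero K}} → (Fin (suc m) → Fin a) → Fin (s * K) → Fin (a ^ s)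
blockString s K S q = chunk s S (toℕ q / K + s * (toℕ q % K))

blockString-at : ∀ {a m} s K .{{_ : NonZero K}} (S : Fin (suc m) → Fin a) (q : Fin (s * K)) {r y} →
  y < K → toℕ q ≡ y + r * K → blockString s K S q ≡ chunk s S (r + s * y)
blockString-at s K S q {r} {y} y<K q≡y+rK = cong (chunk s S) (begin
  toℕ q / K + s * (toℕ q % K)             ≡⟨ cong (λ x → x / K + s * (x % K)) q≡y+rK ⟩
  (y + r * K) / K + s * ((y + r * K) % K) ≡⟨ cong₂ (λ x z → x + s * z) (m<n⇒[m+kn]/n≡k r y<K)
                                                                       (m<n⇒[m+kn]%n≡m r y<K) ⟩
  r + s * y                               ∎)
  where open ≡-Reasoning

blockString-covers : ∀ {a m R} s n K .{{_ : NonZero s}} .{{_ : NonZero n}} .{{_ : NonZero K}} →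
  m / s + n ≤ K → (S : Fin (suc m) → Fin a) →
  IsDBCoveringCode (s * n) R a (suc m) S → IsDBCoveringCode n R (a ^ s) (s * K) (blockString s K S)
blockString-covers {a} {m} {R} s n K m/s+n≤K S cover w = p , bound
  where
  open ≡-Reasoning
  T : Fin (s * K) → Fin (a ^ s)
  T = blockString s K S
  i : Fin (suc m)
  i = proj₁ (cover (unblock s w))
  r j : ℕ
  r = toℕ i % s
  j = toℕ i / s
  r<s : r < s
  r<s = m%n<n (toℕ i) s
  j+k<K : ∀ {k} → k < n → j + k < K
  j+k<K k<n = ≤-trans (+-mono-≤-< (/-monoˡ-≤ s (≤-pred (toℕ<n i))) k<n) m/s+n≤K
  p : Fin (s * K)
  p = fromℕ< (m<n⇒m+k*n<o*n (≤-<-trans (m≤m+n j 0) (j+k<K (>-nonZero⁻¹ n))) r<s)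

  window-T : ∀ k → window n (s * K) T p k ≡ chunk s S (toℕ i + s * toℕ k)
  window-T k = begin
    T (cycIdx (s * K) p (toℕ k))    ≡⟨ blockString-at s K S _ {r} (j+k<K (toℕ<n k)) position ⟩
    chunk s S (r + s * (j + toℕ k)) ≡⟨ cong (chunk s S) offset ⟩
    chunk s S (toℕ i + s * toℕ k)   ∎
    where
    shift : toℕ p + toℕ k ≡ j + toℕ k + r * K
    shift = trans (cong (_+ toℕ k) (toℕ-fromℕ< _)) (xy∙z≈xz∙y j (r * K) (toℕ k))
    position : toℕ (cycIdx (s * K) p (toℕ k)) ≡ j + toℕ k + r * K
    position = trans (toℕ-cycIdx p (toℕ k)
      (subst (_< s * K) (sym shift) (m<n⇒m+k*n<o*n (j+k<K (toℕ<n k)) r<s))) shift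
    offset : r + s * (j + toℕ k) ≡ toℕ i + s * toℕ k
    offset = begin
      r + s * (j + toℕ k)     ≡⟨ cong (r +_) (*-distribˡ-+ s j (toℕ k)) ⟩
      r + (s * j + s * toℕ k) ≡⟨ +-assoc r (s * j) (s * toℕ k) ⟨
      r + s * j + s * toℕ k   ≡⟨ cong (λ x → r + x + s * toℕ k) (*-comm s j) ⟩
      r + j * s + s * toℕ k   ≡⟨ cong (_+ s * toℕ k) (m≡m%n+[m/n]*n (toℕ i) s) ⟨
      toℕ i + s * toℕ k       ∎

  window-S : ∀ k t →
    window (s * n) (suc m) S i (blockIndex k t) ≡ S ((toℕ i + s * toℕ k + toℕ t) mod suc m)
  window-S k t = cong (λ x → S (x mod suc m))
    (trans (cong (toℕ i +_) (toℕ-blockIndex k t)) (sym (+-assoc (toℕ i) (s * toℕ k) (toℕ t))))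

  agree : ∀ k → (∀ t → unblock s w (blockIndex k t) ≡ window (s * n) (suc m) S i (blockIndex k t)) →
    w k ≡ window n (s * K) T p k
  agree k blockAgrees = begin
    w k                               ≡⟨ funToFin-finToFin {m = s} (w k) ⟨
    funToFin (finToFun {n = s} (w k)) ≡⟨ funToFin-cong digits ⟩
    chunk s S (toℕ i + s * toℕ k)     ≡⟨ window-T k ⟨
    window n (s * K) T p k            ∎
    where
    digits : ∀ t → finToFun (w k) t ≡ S ((toℕ i + s * toℕ k + toℕ t) mod suc m)
    digits t = trans (sym (unblock-blockIndex s w k t)) (trans (blockAgrees t) (window-S k t))

  bound : hamming n w (window n (s * K) T p) ≤ R
  bound = ≤-trans (hamming-≤-blocks n s w _ (unblock s w) _ agree) (proj₂ (cover (unblock s w)))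

hasDBCoveringCode-^ : ∀ {a m R} s n .{{_ : NonZero s}} .{{_ : NonZero n}} →
  HasDBCoveringCode (s * n) R a (suc m) → HasDBCoveringCode n R (a ^ s) (s * (n + m / s))
hasDBCoveringCode-^ {m = m} s n@(suc _) (S , cover) =
  blockString s K S , blockString-covers s n K (≤-reflexive (+-comm (m / s) n)) S cover
  where
  K : ℕ
  K = n + m / s

ceilDiv-+-* : ∀ x n s .{{_ : NonZero s}} → ceilDiv (x + s * n) s ≡ ceilDiv x s + n
ceilDiv-+-* x n s@(suc t) = trans
  (cong (_/ s) (trans (xy∙z≈xz∙y x (s * n) t) (cong (x + t +_) (*-comm s n))))
  ([m+kn]/n≡m/n+k (x + t) n s)

ceilDiv-suc : ∀ m s .{{_ : NonZero s}} → ceilDiv (suc m) s ≡ suc (m / s)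
ceilDiv-suc m s@(suc t) = trans
  (cong (_/ s) (trans (sym (+-suc m t)) (cong (m +_) (sym (*-identityˡ s)))))
  (trans ([m+kn]/n≡m/n+k m 1 s) (+-comm (m / s) 1))

m*n≤m*m*[1+n]∸m : ∀ m n .{{_ : NonZero m}} → m * n ≤ m * m * suc n ∸ m
m*n≤m*m*[1+n]∸m m n = begin
  m * n               ≡⟨ m+n∸m≡n m (m * n) ⟨
  m + m * n ∸ m       ≡⟨ cong (_∸ m) (*-suc m n) ⟨
  m * suc n ∸ m       ≤⟨ ∸-monoˡ-≤ m (m≤n*m (m * suc n) m) ⟩
  m * (m * suc n) ∸ m ≡⟨ cong (_∸ m) (*-assoc m m (suc n)) ⟨
  m * m * suc n ∸ m   ∎
  where open ≤-Reasoning

mainTheorem9 : (a b s : ℕ) → 1 ≤ a → 1 ≤ b → 1 ≤ s → a ^ s ≡ b →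
    (n R : ℕ) → 1 ≤ n → 1 ≤ R →
    (m₁ m₂ : ℕ) → IsMinDBLength (s * n) R a m₁ → IsMinDBLength n R b m₂ →
    m₂ ≤ s * s * ceilDiv (m₁ + s * n) s ∸ s
mainTheorem9 (suc _) _ s@(suc _) _ _ _ refl n@(suc _) R _ _ zero m₂ ((_ , cover) , _) _ =
  ⊥-elim (¬Fin0 (proj₁ (cover (λ _ → fzero))))
mainTheorem9 (suc _) _ s@(suc _) _ _ _ refl n@(suc _) R _ _ (suc m) m₂ (code , _) (_ , minimal) = begin
  m₂                                     ≤⟨ minimal _ (hasDBCoveringCode-^ s n code) ⟩
  s * (n + m / s)                        ≤⟨ m*n≤m*m*[1+n]∸m s (n + m / s) ⟩
  s * s * suc (n + m / s) ∸ s            ≡⟨ cong (λ c → s * s * c ∸ s) ceiling ⟨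
  s * s * ceilDiv (suc m + s * n) s ∸ s  ∎
  where
  open ≤-Reasoning
  ceiling : ceilDiv (suc m + s * n) s ≡ suc (n + m / s)
  ceiling = trans (ceilDiv-+-* (suc m) n s)
                  (trans (cong (_+ n) (ceilDiv-suc m s)) (cong suc (+-comm (m / s) n)))
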